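{- In Stage Theory $\mathsf{ST}$: for every set $s$, $s$ is a level iff $s$ is a slice.
   Context: Stage Theory $\mathsf{ST}$: a two-sorted classical second-order theory with set variables and stage variables (second-order variables range over sets), primitives $\in$ (between sets), $<$ (between stages), and "$a$ is found at stage $\mathbf s$". "$a$ is found before $\mathbf s$" means $\exists\mathbf r(a\text{ found at }\mathbf r\land\mathbf r<\mathbf s)$. Axioms: Extensionality; transitivity of $<$; every set is found at some stage; if $a$ is found at $\mathbf s$ then every $x\in a$ is found before $\mathbf s$; for every $F$ and $\mathbf s$, if every $F$ is found before $\mathbf s$ then some set $a$ found at $\mathbf s$ satisfies $\forall x(F(x)\leftrightarrow x\in a)$. For a stage $\mathbf s$, $\mathrm{slice}(\mathbf s)=\{x: x\text{ is found before }\mathbf s\}$; a set is a slice iff it equals $\mathrm{slice}(\mathbf s)$ for some stage $\mathbf s$. $\mathrm{pot}(a)=\{x:\exists c(x\subseteq c\in a)\}$; $h$ is a history iff $x=\mathrm{pot}(x\cap h)$ for all $x\in h$; $s$ is a level iff $s=\mathrm{pot}(h)$ for some history $h$. -}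

module Defs where

open import Level using (Level; suc)
open import Data.Product using (Σ; ∃; _×_; _,_)
open import Data.Sum using (_⊎_)
open import Relation.Nullary using (¬_)
open import Relation.Binary.PropositionalEquality using (_≡_)

-- A model of Stage Theory ST (two-sorted, classical, second-order).
-- Second-order variables are predicates  V → Set ℓ  on the sort of sets.
record ST (ℓ : Level) : Set (suc ℓ) where
  infix 4 _∈_ _<_
  field
    V     : Set ℓ
    Stg   : Set ℓ
    _∈_   : V → V → Set ℓ
    _<_   : Stg → Stg → Set ℓ
    found : V → Stg → Set ℓ

  FoundBefore : V → Stg → Set ℓ
  FoundBefore a s = Σ Stg λ r → found a r × r < s

  field
    lem : (P : Set ℓ) → P ⊎ ¬ P
    extensionality : ∀ a b → (∀ x → (x ∈ a → x ∈ b) × (x ∈ b → x ∈ a)) → a ≡ b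
    <-trans : ∀ {r s t} → r < s → s < t → r < t
    found-somewhere : ∀ a → Σ Stg λ s → found a s
    found-elements : ∀ a s → found a s → ∀ x → x ∈ a → FoundBefore x s
    specification : (F : V → Set ℓ) (s : Stg) →
      (∀ x → F x → FoundBefore x s) →
      Σ V λ a → found a s × (∀ x → (F x → x ∈ a) × (x ∈ a → F x))

  _⊆_ : V → V → Set ℓ
  x ⊆ y = ∀ z → z ∈ x → z ∈ y

  IsSliceOf : V → Stg → Set ℓ
  IsSliceOf a s = ∀ x → (x ∈ a → FoundBefore x s) × (FoundBefore x s → x ∈ a)

  IsSlice : V → Set ℓ
  IsSlice a = Σ Stg λ s → IsSliceOf a s

  IsPot : V → V → Set ℓ
  IsPot a p = ∀ x → (x ∈ p → Σ V λ c → x ⊆ c × c ∈ a)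
                  × (Σ V (λ c → x ⊆ c × c ∈ a) → x ∈ p)

  IsPotCap : V → V → V → Set ℓ
  IsPotCap x h p = ∀ y → (y ∈ p → Σ V λ c → y ⊆ c × (c ∈ x × c ∈ h))
                       × (Σ V (λ c → y ⊆ c × (c ∈ x × c ∈ h)) → y ∈ p)

  IsHistory : V → Set ℓ
  IsHistory h = ∀ x → x ∈ h → IsPotCap x h x

  IsLevel : V → Set ℓ
  IsLevel s = Σ V λ h → IsHistory h × IsPot h s

{-# OPTIONS --safe #-}
module Submission where

open import Defs
open import Level using (Level)
open import Data.Product using (_×_; Σ; _,_; proj₁; proj₂)
open import Data.Sum using (_⊎_; inj₁; inj₂; [_,_]′)
open import Data.Empty using (⊥-elim)
open import Relation.Nullary using (¬_)
open import Relation.Binary.PropositionalEquality using (subst)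

-- Stages are well-founded (a Russell-style argument on the sets found before
-- all stages of a descending family), and any two stages are comparable in
-- the sense that one slice is included in the other, strictly so unless they
-- coincide. Hence a set p = pot(K) of a family K of slices is a slice: at the
-- least stage t where p is found, every set found below t lies under some
-- c ∈ K whose stage is at least as high. Elements of a history are slices by
-- ∈-induction, so levels are slices. Conversely slice(t) is pot of the
-- history {slice(r) : r < t}.

module StageTheory {ℓ : Level} (M : ST ℓ) where
  open ST M

  ¬¬-elim : ∀ {P : Set ℓ} → ¬ ¬ P → P
  ¬¬-elim {P} ¬¬p with lem P
  ... | inj₁ p  = p
  ... | inj₂ ¬p = ⊥-elim (¬¬p ¬p)

  found-of-elements-before : ∀ y r → (∀ z → z ∈ y → FoundBefore z r) → found y r
  found-of-elements-before y r before with specification (_∈ y) r before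
  ... | a , found-a , a≈y =
    subst (λ w → found w r) (extensionality a y (λ x → proj₂ (a≈y x) , proj₁ (a≈y x))) found-a

  found-⊆ : ∀ {x c r} → x ⊆ c → found c r → found x r
  found-⊆ {x} {c} {r} x⊆c found-c =
    found-of-elements-before x r (λ z z∈x → found-elements c r found-c z (x⊆c z z∈x))

  <-minimal : (Q : Stg → Set ℓ) → ∀ q₀ → Q q₀ → Σ Stg λ q → Q q × (∀ r → r < q → ¬ Q r)
  <-minimal Q q₀ Qq₀ with lem (Σ Stg λ q → Q q × (∀ r → r < q → ¬ Q r))
  ... | inj₁ minimal    = minimal
  ... | inj₂ no-minimal = ⊥-elim (g∉g (proj₁ (g-spec g) (g-before-Q , g∉g)))
    where
    descent : ∀ q → Q q → Σ Stg λ r → r < q × Q r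
    descent q Qq = ¬¬-elim λ none → no-minimal (q , Qq , λ r r<q Qr → none (r , r<q , Qr))

    BeforeAllQ : V → Set ℓ
    BeforeAllQ x = ∀ q → Q q → FoundBefore x q

    Russell : V → Set ℓ
    Russell x = BeforeAllQ x × ¬ x ∈ x

    russell-set : Σ V λ a → found a q₀ × (∀ x → (Russell x → x ∈ a) × (x ∈ a → Russell x))
    russell-set = specification Russell q₀ (λ x Rx → proj₁ Rx q₀ Qq₀)

    g : V
    g = proj₁ russell-set

    g-spec : ∀ x → (Russell x → x ∈ g) × (x ∈ g → Russell x)
    g-spec = proj₂ (proj₂ russell-set)

    g-before-Q : BeforeAllQ g
    g-before-Q q Qq with descent q Qq
    ... | r , r<q , Qr =
      r , found-of-elements-before g r (λ z z∈g → proj₁ (proj₂ (g-spec z) z∈g) r Qr) , r<q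

    g∉g : ¬ g ∈ g
    g∉g g∈g = proj₂ (proj₂ (g-spec g) g∈g) g∈g

  <-induction : (P : Stg → Set ℓ) → (∀ r → (∀ q → q < r → P q) → P r) → ∀ r → P r
  <-induction P step r with lem (P r)
  ... | inj₁ Pr  = Pr
  ... | inj₂ ¬Pr with <-minimal (λ q → ¬ P q) r ¬Pr
  ... | q , ¬Pq , below = ⊥-elim (¬Pq (step q (λ q′ q′<q → ¬¬-elim (below q′ q′<q))))

  ∈-induction : (P : V → Set ℓ) → (∀ a → (∀ x → x ∈ a → P x) → P a) → ∀ a → P a
  ∈-induction P step a = <-induction P-at step′ (proj₁ stage) a (proj₂ stage)
    where
    P-at : Stg → Set ℓ
    P-at r = ∀ a → found a r → P a

    stage : Σ Stg (found a)
    stage = found-somewhere a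

    step′ : ∀ r → (∀ q → q < r → P-at q) → P-at r
    step′ r IH a found-a = step a λ x x∈a →
      let (q , found-x , q<r) = found-elements a r found-a x x∈a in IH q q<r x found-x

  infix 4 _⊑_ _⊏_

  _⊑_ : Stg → Stg → Set ℓ
  r ⊑ r′ = ∀ x → FoundBefore x r → FoundBefore x r′

  _⊏_ : Stg → Stg → Set ℓ
  r ⊏ r′ = Σ Stg λ q → q < r′ × r ⊑ q

  found-mono : ∀ {y r r′} → r ⊑ r′ → found y r → found y r′
  found-mono {y} {r} {r′} r⊑r′ found-y =
    found-of-elements-before y r′ (λ z z∈y → r⊑r′ z (found-elements y r found-y z z∈y))

  found-before-of-⊏ : ∀ {x r r′} → found x r → r ⊏ r′ → FoundBefore x r′
  found-before-of-⊏ found-x (q , q<r′ , r⊑q) = q , found-mono r⊑q found-x , q<r′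

  ⊏-or-⊒-step : ∀ {a b} → (∀ b′ → b′ < b → b′ ⊏ a ⊎ a ⊑ b′) → a ⊏ b ⊎ b ⊑ a
  ⊏-or-⊒-step {a} {b} IH with lem (a ⊏ b)
  ... | inj₁ a⊏b = inj₁ a⊏b
  ... | inj₂ a⋢b = inj₂ λ where
    x (b′ , found-x , b′<b) →
      [ found-before-of-⊏ found-x , (λ a⊑b′ → ⊥-elim (a⋢b (b′ , b′<b , a⊑b′))) ]′ (IH b′ b′<b)

  -- The two halves support each other's inductions, so they are proved jointly.
  comparable : ∀ a b → (a ⊏ b ⊎ b ⊑ a) × (b ⊏ a ⊎ a ⊑ b)
  comparable = <-induction _ λ a IHa → <-induction _ λ b IHb →
    ⊏-or-⊒-step (λ b′ b′<b → proj₂ (IHb b′ b′<b)) ,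
    ⊏-or-⊒-step (λ a′ a′<a → proj₁ (IHa a′ a′<a b))

  ⊏-or-⊒ : ∀ a b → a ⊏ b ⊎ b ⊑ a
  ⊏-or-⊒ a b = proj₁ (comparable a b)

  slice-exists : ∀ r → Σ V λ c → IsSliceOf c r
  slice-exists r with specification (λ x → FoundBefore x r) r (λ x before → before)
  ... | c , _ , c≈slice = c , λ x → proj₂ (c≈slice x) , proj₁ (c≈slice x)

  found-slice : ∀ {c r} → IsSliceOf c r → found c r
  found-slice {c} {r} c≈slice = found-of-elements-before c r (λ z z∈c → proj₁ (c≈slice z) z∈c)

  ⊆-slice : ∀ {x c r} → IsSliceOf c r → found x r → x ⊆ c
  ⊆-slice {x} {c} {r} c≈slice found-x z z∈x = proj₂ (c≈slice z) (found-elements x r found-x z z∈x)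

  IsPotOf : (V → Set ℓ) → V → Set ℓ
  IsPotOf K p = ∀ y → (y ∈ p → Σ V λ c → y ⊆ c × K c) × (Σ V (λ c → y ⊆ c × K c) → y ∈ p)

  pot-cofinal : ∀ {K K′ p} → (∀ c → K c → K′ c) → (∀ c → K′ c → Σ V λ d → c ⊆ d × K d) →
                IsPotOf K p → IsPotOf K′ p
  pot-cofinal K⇒K′ K′⊆K p≈pot y = forth , back
    where
    forth : y ∈ _ → Σ V λ c → y ⊆ c × _
    forth y∈p with proj₁ (p≈pot y) y∈p
    ... | c , y⊆c , Kc = c , y⊆c , K⇒K′ c Kc
    back : Σ V (λ c → y ⊆ c × _) → y ∈ _
    back (c , y⊆c , K′c) with K′⊆K c K′c
    ... | d , c⊆d , Kd = proj₂ (p≈pot y) (d , (λ z z∈y → c⊆d z (y⊆c z z∈y)) , Kd)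

  element-not-before : ∀ {s u} → ¬ found s u → Σ V λ y → y ∈ s × ¬ FoundBefore y u
  element-not-before {s} {u} ¬found-s = ¬¬-elim λ none →
    ¬found-s (found-of-elements-before s u (λ z z∈s → ¬¬-elim (λ ¬before → none (z , z∈s , ¬before))))

  pot-of-slices-is-slice : ∀ K p → (∀ c → K c → IsSlice c) → IsPotOf K p → IsSlice p
  pot-of-slices-is-slice K p slices p≈pot
    with <-minimal (found p) (proj₁ (found-somewhere p)) (proj₂ (found-somewhere p))
  ... | t , found-p , minimal = t , λ y → found-elements p t found-p y , below-t y
    where
    below-t : ∀ y → FoundBefore y t → y ∈ p
    below-t y (u , found-y , u<t) with element-not-before (minimal u u<t)
    ... | y₀ , y₀∈p , y₀-late with proj₁ (p≈pot y₀) y₀∈p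
    ... | c , y₀⊆c , Kc with slices c Kc
    ... | r , c≈slice with ⊏-or-⊒ r u
    ... | inj₁ r⊏u = ⊥-elim (y₀-late (found-before-of-⊏ (found-⊆ y₀⊆c (found-slice c≈slice)) r⊏u))
    ... | inj₂ u⊑r = proj₂ (p≈pot y) (c , ⊆-slice c≈slice (found-mono u⊑r found-y) , Kc)

  history-elements-are-slices : ∀ {h} → IsHistory h → ∀ c → c ∈ h → IsSlice c
  history-elements-are-slices {h} history = ∈-induction (λ c → c ∈ h → IsSlice c) λ c IH c∈h →
    pot-of-slices-is-slice (λ d → d ∈ c × d ∈ h) c
      (λ d (d∈c , d∈h) → IH d d∈c d∈h) (history c c∈h)

  level⇒slice : ∀ s → IsLevel s → IsSlice s
  level⇒slice s (h , history , s≈pot) =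
    pot-of-slices-is-slice (_∈ h) s (history-elements-are-slices history) s≈pot

  LowerSlice : Stg → V → Set ℓ
  LowerSlice t c = Σ Stg λ r → r < t × IsSliceOf c r

  slice-is-pot-of-lower-slices : ∀ {s t} → IsSliceOf s t → IsPotOf (LowerSlice t) s
  slice-is-pot-of-lower-slices {s} {t} s≈slice y = forth , back
    where
    forth : y ∈ s → Σ V λ c → y ⊆ c × LowerSlice t c
    forth y∈s with proj₁ (s≈slice y) y∈s
    ... | r , found-y , r<t with slice-exists r
    ... | c , c≈slice = c , ⊆-slice c≈slice found-y , r , r<t , c≈slice
    back : Σ V (λ c → y ⊆ c × LowerSlice t c) → y ∈ s
    back (c , y⊆c , r , r<t , c≈slice) =
      proj₂ (s≈slice y) (r , found-⊆ y⊆c (found-slice c≈slice) , r<t)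

  slice⇒level : ∀ s → IsSlice s → IsLevel s
  slice⇒level s (t , s≈slice) = h , history , s≈pot
    where
    lower-slices : Σ V λ a → found a t × (∀ c → (LowerSlice t c → c ∈ a) × (c ∈ a → LowerSlice t c))
    lower-slices = specification (LowerSlice t) t
      (λ c (r , r<t , c≈slice) → r , found-slice c≈slice , r<t)

    h : V
    h = proj₁ lower-slices

    h-spec : ∀ c → (LowerSlice t c → c ∈ h) × (c ∈ h → LowerSlice t c)
    h-spec = proj₂ (proj₂ lower-slices)

    s≈pot : IsPot h s
    s≈pot = pot-cofinal (λ c → proj₁ (h-spec c))
      (λ c c∈h → c , (λ z z∈c → z∈c) , proj₂ (h-spec c) c∈h)
      (slice-is-pot-of-lower-slices s≈slice)

    history : IsHistory h
    history x x∈h with proj₂ (h-spec x) x∈h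
    ... | r , r<t , x≈slice = pot-cofinal lower⇒in-x∩h in-x∩h⇒under-lower
                                (slice-is-pot-of-lower-slices x≈slice)
      where
      lower⇒in-x∩h : ∀ c → LowerSlice r c → c ∈ x × c ∈ h
      lower⇒in-x∩h c (q , q<r , c≈slice) =
        proj₂ (x≈slice c) (q , found-slice c≈slice , q<r) ,
        proj₁ (h-spec c) (q , <-trans q<r r<t , c≈slice)
      in-x∩h⇒under-lower : ∀ c → c ∈ x × c ∈ h → Σ V λ d → c ⊆ d × LowerSlice r d
      in-x∩h⇒under-lower c (c∈x , _) with proj₁ (x≈slice c) c∈x
      ... | u , found-c , u<r with slice-exists u
      ... | d , d≈slice = d , ⊆-slice d≈slice found-c , u , u<r , d≈slice

lemma21 : ∀ {ℓ : Level} (M : ST ℓ) → (s : ST.V M) →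
    (ST.IsLevel M s → ST.IsSlice M s) × (ST.IsSlice M s → ST.IsLevel M s)
lemma21 M s = StageTheory.level⇒slice M s , StageTheory.slice⇒level M s
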